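{- Let $\langle W,R,S,v\rangle$ be a PS4 model and $x,y\in W$ with $xSy$. Then for every formula $\phi$, if $v(\phi,x)\in\{1,0\}$ then $v(\phi,y)=v(\phi,x)$.
   Context: Formulas are built from atoms using $\neg,\Box,\land,\lor$. A PS4 frame is $\langle W,R,S\rangle$ with $W\neq\emptyset$ and $R,S\subseteq W\times W$ such that: $S$ is reflexive; $R$ is reflexive; (Pseudo-Transitivity) if $xRy$ and $yRz$ then there is $w$ with $xRw$ and $zSw$; (Forth) if $xRy$ and $xSz$ then there is $w$ with $zRw$ and $ySw$; (Back) if $xSz$ and $zRw$ then there is $y$ with $xRy$ and $ySw$. A PS4 model is $\langle W,R,S,v\rangle$ with $\langle W,R,S\rangle$ a PS4 frame and $v$ assigning to each formula and point a value in $\{1,*,0\}$ satisfying the strong Kleene clauses: $v(\neg\phi,x)=1$ iff $v(\phi,x)=0$, and $=0$ iff $v(\phi,x)=1$; $v(\phi\land\psi,x)=1$ iff both are $1$, $=0$ iff at least one is $0$; $v(\phi\lor\psi,x)=1$ iff at least one is $1$, $=0$ iff both are $0$; $v(\Box\phi,x)=1$ iff $v(\phi,y)=1$ for all $y$ with $xRy$, and $v(\Box\phi,x)=0$ iff $v(\phi,y)=0$ for some $y$ with $xRy$ (otherwise values are $*$). Moreover ($S$ information preservation) whenever $xSy$, for every atom $p$ with $v(p,x)\in\{1,0\}$ we have $v(p,y)=v(p,x)$. -}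

module Defs where

open import Data.Product using (Σ; ∃; _×_; _,_)
open import Data.Sum using (_⊎_)
open import Relation.Binary.PropositionalEquality using (_≡_)
open import Relation.Nullary using (¬_)

data V3 : Set where
  one star zero : V3

data Form (Atom : Set) : Set where
  atom : Atom → Form Atom
  ~_   : Form Atom → Form Atom
  □_   : Form Atom → Form Atom
  _∧_  : Form Atom → Form Atom → Form Atom
  _∨_  : Form Atom → Form Atom → Form Atom

infix 5 _⇔_
_⇔_ : Set → Set → Set
A ⇔ B = (A → B) × (B → A)

Classical : V3 → Set
Classical a = (a ≡ one) ⊎ (a ≡ zero)

record PS4Frame : Set₁ where
  field
    W : Set
    w₀ : W                       -- W ≠ ∅
    R : W → W → Set
    S : W → W → Set
    S-refl : ∀ x → S x x
    R-refl : ∀ x → R x x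
    pseudoTrans : ∀ {x y z} → R x y → R y z → ∃ λ w → R x w × S z w
    forth : ∀ {x y z} → R x y → S x z → ∃ λ w → R z w × S y w
    back  : ∀ {x z w} → S x z → R z w → ∃ λ y → R x y × S y w

record PS4Model (Atom : Set) : Set₁ where
  field
    frame : PS4Frame
  open PS4Frame frame public
  field
    v : Form Atom → W → V3
    v-neg-1 : ∀ φ x → (v (~ φ) x ≡ one) ⇔ (v φ x ≡ zero)
    v-neg-0 : ∀ φ x → (v (~ φ) x ≡ zero) ⇔ (v φ x ≡ one)
    v-and-1 : ∀ φ ψ x → (v (φ ∧ ψ) x ≡ one) ⇔ ((v φ x ≡ one) × (v ψ x ≡ one))
    v-and-0 : ∀ φ ψ x → (v (φ ∧ ψ) x ≡ zero) ⇔ ((v φ x ≡ zero) ⊎ (v ψ x ≡ zero))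
    v-or-1  : ∀ φ ψ x → (v (φ ∨ ψ) x ≡ one) ⇔ ((v φ x ≡ one) ⊎ (v ψ x ≡ one))
    v-or-0  : ∀ φ ψ x → (v (φ ∨ ψ) x ≡ zero) ⇔ ((v φ x ≡ zero) × (v ψ x ≡ zero))
    v-box-1 : ∀ φ x → (v (□ φ) x ≡ one) ⇔ (∀ y → R x y → v φ y ≡ one)
    v-box-0 : ∀ φ x → (v (□ φ) x ≡ zero) ⇔ (∃ λ y → R x y × v φ y ≡ zero)
    S-atom : ∀ {x y} → S x y → ∀ p → Classical (v (atom p) x) → v (atom p) y ≡ v (atom p) x

{-# OPTIONS --safe #-}
module Submission where

open import Defs
open import Relation.Binary.PropositionalEquality using (_≡_; sym; trans)
open import Data.Product using (_,_; proj₁; proj₂)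
open import Data.Sum using (inj₁; inj₂)

-- Simultaneous induction on φ, preserving the values 1 and 0 separately; negation swaps
-- the two. For □, a value 1 is carried along S by Back (every R-successor of y is
-- S-reached from an R-successor of x), and a value 0 by Forth (a 0-witness below x is
-- S-related to an R-successor of y).

module _ {Atom : Set} (M : PS4Model Atom) where
  open PS4Model M

  S-preserves-one  : ∀ φ {x y} → S x y → v φ x ≡ one  → v φ y ≡ one
  S-preserves-zero : ∀ φ {x y} → S x y → v φ x ≡ zero → v φ y ≡ zero

  S-preserves-one (atom p) s e = trans (S-atom s p (inj₁ e)) e
  S-preserves-one (~ φ) {x} {y} s e =
    proj₂ (v-neg-1 φ y) (S-preserves-zero φ s (proj₁ (v-neg-1 φ x) e))
  S-preserves-one (□ φ) {x} {y} s e = proj₂ (v-box-1 φ y) λ w ryw →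
    let (u , rxu , suw) = back s ryw
    in S-preserves-one φ suw (proj₁ (v-box-1 φ x) e u rxu)
  S-preserves-one (φ ∧ ψ) {x} {y} s e =
    let (eφ , eψ) = proj₁ (v-and-1 φ ψ x) e
    in proj₂ (v-and-1 φ ψ y) (S-preserves-one φ s eφ , S-preserves-one ψ s eψ)
  S-preserves-one (φ ∨ ψ) {x} {y} s e with proj₁ (v-or-1 φ ψ x) e
  ... | inj₁ eφ = proj₂ (v-or-1 φ ψ y) (inj₁ (S-preserves-one φ s eφ))
  ... | inj₂ eψ = proj₂ (v-or-1 φ ψ y) (inj₂ (S-preserves-one ψ s eψ))

  S-preserves-zero (atom p) s e = trans (S-atom s p (inj₂ e)) e
  S-preserves-zero (~ φ) {x} {y} s e =
    proj₂ (v-neg-0 φ y) (S-preserves-one φ s (proj₁ (v-neg-0 φ x) e))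
  S-preserves-zero (□ φ) {x} {y} s e =
    let (u , rxu , eu) = proj₁ (v-box-0 φ x) e
        (w , ryw , suw) = forth rxu s
    in proj₂ (v-box-0 φ y) (w , ryw , S-preserves-zero φ suw eu)
  S-preserves-zero (φ ∧ ψ) {x} {y} s e with proj₁ (v-and-0 φ ψ x) e
  ... | inj₁ eφ = proj₂ (v-and-0 φ ψ y) (inj₁ (S-preserves-zero φ s eφ))
  ... | inj₂ eψ = proj₂ (v-and-0 φ ψ y) (inj₂ (S-preserves-zero ψ s eψ))
  S-preserves-zero (φ ∨ ψ) {x} {y} s e =
    let (eφ , eψ) = proj₁ (v-or-0 φ ψ x) e
    in proj₂ (v-or-0 φ ψ y) (S-preserves-zero φ s eφ , S-preserves-zero ψ s eψ)

mainTheorem9 : {Atom : Set} (M : PS4Model Atom) (x y : PS4Model.W M) →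
    PS4Model.S M x y → (φ : Form Atom) →
    Classical (PS4Model.v M φ x) → PS4Model.v M φ y ≡ PS4Model.v M φ x
mainTheorem9 M x y s φ (inj₁ e) = trans (S-preserves-one M φ s e) (sym e)
mainTheorem9 M x y s φ (inj₂ e) = trans (S-preserves-zero M φ s e) (sym e)
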